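{- For integers $0\le k\le n-1$ and $\lambda\in\mathbb C$, \[ d^k_n(\lambda)=n\,d^k_{n-1}(\lambda)+(\lambda-1)\,d^{k-1}_{n-2}(\lambda). \]
   Context: For integers $0\le k\le n$, define polynomials $e^k_n(\lambda)$ by $e^n_n(\lambda)=n!$ and $e^{k-1}_n(\lambda)=e^k_n(\lambda)+(\lambda-1)e^{k-1}_{n-1}(\lambda)$ for $1\le k\le n$; equivalently $e^k_n(\lambda)=\sum_{\pi\in S_n}\lambda^{\#\{i>k:\ \pi_i=i\}}$. Define $d^k_n(\lambda)=e^k_n(\lambda)/k!$. For $k=-1$ use the convention $d^{ -1}_m(\lambda)=(\lambda-1)^{m+1}$ for $m\ge-1$ (so $d^{ -1}_{ -1}=1$). -}

module Defs where

open import Data.Nat as ℕ using (ℕ; zero; suc; _∸_; _!)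
open import Data.Nat.Properties using (_!≢0)
open import Data.Integer as ℤ using (+_)
open import Data.Rational using (ℚ; 0ℚ; 1ℚ; _+_; _-_; _*_; _/_)

-- Polynomials in λ with rational coefficients, represented by their
-- coefficient sequence: p i is the coefficient of λ^i.
Poly : Set
Poly = ℕ → ℚ

const : ℚ → Poly
const c zero    = c
const c (suc i) = 0ℚ

_⊕_ : Poly → Poly → Poly
(p ⊕ q) i = p i + q i

_·_ : ℚ → Poly → Poly
(c · p) i = c * p i

mulλ : Poly → Poly
mulλ p zero    = 0ℚ
mulλ p (suc i) = p i

mulλ-1 : Poly → Poly
mulλ-1 p i = mulλ p i - p i

powλ-1 : ℕ → Poly
powλ-1 zero    = const 1ℚ
powλ-1 (suc m) = mulλ-1 (powλ-1 m)

-- f n j = e^{n-j}_n, for j ≤ n, via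
--   e^n_n = n!,  e^{k-1}_n = e^k_n + (λ-1) e^{k-1}_{n-1}
-- (with k = n - j, so n-1-(k-1) = j). Values with j > n are junk.
f : ℕ → ℕ → Poly
f n       zero    = const ((+ (n !)) / 1)
f zero    (suc j) = const 0ℚ
f (suc n) (suc j) = f (suc n) j ⊕ mulλ-1 (f n j)

-- e^k_n(λ), meaningful for k ≤ n
e : ℕ → ℕ → Poly
e k n = f n (n ∸ k)

d : ℕ → ℕ → Poly
d k n = ((+ 1) / (k !)) {{k !≢0}} · e k n

-- dShift k m = d^{k-1}_{m-1}, covering the convention
-- d^{-1}_{m-1} = (λ-1)^m  (m ≥ 0).  dShift (suc k) 0 is junk (d^k_{-1}).
dShift : ℕ → ℕ → Poly
dShift zero    m       = powλ-1 m
dShift (suc k) zero    = const 0ℚ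
dShift (suc k) (suc m) = d k m

module Submission where

-- Everything rests on
-- two recurrences for the e-polynomials, proved by induction on j directly from
-- the defining recurrence e^{k-1}_n = e^k_n + (λ-1) e^{k-1}_{n-1}:
--
--   (inner)     e^{k}_n   = n e^{k}_{n-1} + k (λ-1) e^{k-1}_{n-2}     (1 ≤ k ≤ n-1)
--   (diagonal)  e^0_{m+1} = (m+1) e^0_m + (λ-1)^{m+1}.
--
-- Dividing (inner) by k! and using k/k! = 1/(k-1)! gives the claim for k ≥ 1;
-- (diagonal) is the claim for k = 0 under the convention d^{-1}_m = (λ-1)^{m+1}.

open import Defs
open import Data.Nat as ℕ using (ℕ; zero; suc; _<_; _∸_; _!; NonZero; s≤s)
open import Data.Nat.Properties as ℕP using (_!≢0; +-suc; m+n∸m≡n; m≤n⇒∃[o]m+o≡n)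
open import Data.Integer as ℤ using (ℤ; +_)
open import Data.Integer.Properties using (pos-*)
open import Data.Rational using (ℚ; 0ℚ; 1ℚ; _+_; _-_; _*_; _/_; toℚᵘ)
open import Data.Rational.Properties
  using (toℚᵘ-injective; toℚᵘ-fromℚᵘ; toℚᵘ-homo-+; toℚᵘ-homo-*;
         *-identityˡ; *-zeroˡ; *-zeroʳ; *-distribˡ-+; +-identityˡ)
import Data.Rational.Unnormalised as U
import Data.Rational.Unnormalised.Properties as UP
open import Data.Product using (_,_)
open import Relation.Binary.PropositionalEquality
  using (_≡_; _≗_; refl; sym; trans; cong; cong₂; module ≡-Reasoning)
import Data.Integer.Solver as ℤSolver
open import Data.Rational.Solver using (module +-*-Solver)

ι : ℕ → ℚ
ι n = (+ n) / 1

inv! : ℕ → ℚ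
inv! k = ((+ 1) / (k !)) {{k !≢0}}

-- A normalised quotient i / n denotes the unnormalised fraction i / n; this
-- lets us transfer identities from ℚᵘ, where they are integer identities.
toℚᵘ-/ : ∀ (i : ℤ) n .{{_ : NonZero n}} → toℚᵘ (i / n) U.≃ (i U./ n)
toℚᵘ-/ i (suc n) = toℚᵘ-fromℚᵘ (U.mkℚᵘ i n)

ι-suc : ∀ n → ι (suc n) ≡ 1ℚ + ι n
ι-suc n = toℚᵘ-injective (begin
  toℚᵘ (ι (suc n))              ≈⟨ toℚᵘ-/ (+ suc n) 1 ⟩
  (+ suc n) U./ 1               ≈⟨ U.*≡* cross ⟩
  U.1ℚᵘ U.+ ((+ n) U./ 1)       ≈⟨ UP.+-cong UP.≃-refl (toℚᵘ-/ (+ n) 1) ⟨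
  toℚᵘ 1ℚ U.+ toℚᵘ (ι n)        ≈⟨ toℚᵘ-homo-+ 1ℚ (ι n) ⟨
  toℚᵘ (1ℚ + ι n)               ∎)
  where
  open UP.≃-Reasoning
  open ℤSolver.+-*-Solver
  cross : (+ suc n) ℤ.* + 1 ≡ (+ 1 ℤ.* + 1 ℤ.+ + n ℤ.* + 1) ℤ.* + 1
  cross = solve 1 (λ x → (con (+ 1) :+ x) :* con (+ 1)
                      := (con (+ 1) :* con (+ 1) :+ x :* con (+ 1)) :* con (+ 1))
                  refl (+ n)

ι-* : ∀ m n → ι (m ℕ.* n) ≡ ι m * ι n
ι-* m n = toℚᵘ-injective (begin
  toℚᵘ (ι (m ℕ.* n))             ≈⟨ toℚᵘ-/ (+ (m ℕ.* n)) 1 ⟩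
  (+ (m ℕ.* n)) U./ 1            ≈⟨ U.*≡* cross ⟩
  ((+ m) U./ 1) U.* ((+ n) U./ 1) ≈⟨ UP.*-cong (toℚᵘ-/ (+ m) 1) (toℚᵘ-/ (+ n) 1) ⟨
  toℚᵘ (ι m) U.* toℚᵘ (ι n)      ≈⟨ toℚᵘ-homo-* (ι m) (ι n) ⟨
  toℚᵘ (ι m * ι n)               ∎)
  where
  open UP.≃-Reasoning
  open ℤSolver.+-*-Solver
  cross : (+ (m ℕ.* n)) ℤ.* (+ 1 ℤ.* + 1) ≡ (+ m ℤ.* + n) ℤ.* + 1
  cross = trans (cong (ℤ._* (+ 1 ℤ.* + 1)) (pos-* m n))
                (solve 2 (λ x y → (x :* y) :* (con (+ 1) :* con (+ 1)) := (x :* y) :* con (+ 1))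
                         refl (+ m) (+ n))

reciprocal-cancel : ∀ a b .{{_ : NonZero b}} →
  ((+ 1) / (suc a ℕ.* b)) {{ℕP.m*n≢0 (suc a) b}} * ι (suc a) ≡ (+ 1) / b
reciprocal-cancel a (suc b) = toℚᵘ-injective (begin
  toℚᵘ (q * ι (suc a))                                  ≈⟨ toℚᵘ-homo-* q (ι (suc a)) ⟩
  toℚᵘ q U.* toℚᵘ (ι (suc a))                           ≈⟨ UP.*-cong (toℚᵘ-/ (+ 1) (suc a ℕ.* suc b))
                                                                      (toℚᵘ-/ (+ suc a) 1) ⟩
  ((+ 1) U./ (suc a ℕ.* suc b)) U.* ((+ suc a) U./ 1)   ≈⟨ U.*≡* cross ⟩
  (+ 1) U./ suc b                                       ≈⟨ toℚᵘ-/ (+ 1) (suc b) ⟨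
  toℚᵘ ((+ 1) / suc b)                                  ∎)
  where
  open UP.≃-Reasoning
  open ℤSolver.+-*-Solver
  q : ℚ
  q = (+ 1) / (suc a ℕ.* suc b)
  cross : (+ 1 ℤ.* + suc a) ℤ.* + suc b ≡ + 1 ℤ.* ((+ suc a ℤ.* + suc b) ℤ.* + 1)
  cross = solve 2 (λ x y → (con (+ 1) :* x) :* y := con (+ 1) :* ((x :* y) :* con (+ 1)))
                  refl (+ suc a) (+ suc b)

inv!-suc : ∀ k → inv! (suc k) * ι (suc k) ≡ inv! k
inv!-suc k = reciprocal-cancel k (k !) {{k !≢0}}

open +-*-Solver

mulλ-1-cong : ∀ {p q} → p ≗ q → mulλ-1 p ≗ mulλ-1 q
mulλ-1-cong p≗q zero    = cong (0ℚ -_) (p≗q zero)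
mulλ-1-cong p≗q (suc i) = cong₂ _-_ (p≗q i) (p≗q (suc i))

mulλ-1-⊕ : ∀ p q → mulλ-1 (p ⊕ q) ≗ mulλ-1 p ⊕ mulλ-1 q
mulλ-1-⊕ p q zero    = solve 2 (λ x y → con 0ℚ :- (x :+ y) := (con 0ℚ :- x) :+ (con 0ℚ :- y))
                                refl (p 0) (q 0)
mulλ-1-⊕ p q (suc i) = solve 4 (λ a b x y → (a :+ b) :- (x :+ y) := (a :- x) :+ (b :- y))
                                refl (p i) (q i) (p (suc i)) (q (suc i))

mulλ-1-· : ∀ c p → mulλ-1 (c · p) ≗ c · mulλ-1 p
mulλ-1-· c p zero    = solve 2 (λ c x → con 0ℚ :- c :* x := c :* (con 0ℚ :- x)) refl c (p 0)
mulλ-1-· c p (suc i) = solve 3 (λ c a x → c :* a :- c :* x := c :* (a :- x)) refl c (p i) (p (suc i))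

mulλ-1-combination : ∀ a b p q → mulλ-1 ((a · p) ⊕ (b · q)) ≗ (a · mulλ-1 p) ⊕ (b · mulλ-1 q)
mulλ-1-combination a b p q i =
  trans (mulλ-1-⊕ (a · p) (b · q) i) (cong₂ _+_ (mulλ-1-· a p i) (mulλ-1-· b q i))

const-* : ∀ a b → const (a * b) ≗ a · const b
const-* a b zero    = refl
const-* a b (suc i) = sym (*-zeroʳ a)

ι-regroup : ∀ m n a b t →
  (ι (suc m) * a + ι (suc n) * b) + (ι m * b + t) ≡ ι (suc m) * (a + b) + (ι n * b + t)
ι-regroup m n a b t = begin
  (ι (suc m) * a + ι (suc n) * b) + (ι m * b + t)
    ≡⟨ cong₂ (λ u v → (u * a + v * b) + (ι m * b + t)) (ι-suc m) (ι-suc n) ⟩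
  ((1ℚ + ι m) * a + (1ℚ + ι n) * b) + (ι m * b + t)
    ≡⟨ solve 5 (λ x y a b t → ((con 1ℚ :+ x) :* a :+ (con 1ℚ :+ y) :* b) :+ (x :* b :+ t)
                            := (con 1ℚ :+ x) :* (a :+ b) :+ (y :* b :+ t))
               refl (ι m) (ι n) a b t ⟩
  (1ℚ + ι m) * (a + b) + (ι n * b + t)
    ≡⟨ cong (λ u → u * (a + b) + (ι n * b + t)) (ι-suc m) ⟨
  ι (suc m) * (a + b) + (ι n * b + t)
    ∎
  where open ≡-Reasoning

f-top : ∀ n → f (suc n) 0 ≗ ι (suc n) · f n 0
f-top n i = trans (cong (λ c → const c i) (ι-* (suc n) (n !))) (const-* (ι (suc n)) (ι (n !)) i)

-- (inner) e^{r+1}_{s+2} = (s+2) e^{r+1}_{s+1} + (r+1)(λ-1) e^r_s  where s = j + r,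
-- by induction on j; the step combines the two instances (j, r+1) and (j, r)
-- through the defining recurrence.
f-inner : ∀ j r {s} → j ℕ.+ r ≡ s →
  f (suc (suc s)) (suc j) ≗ (ι (suc (suc s)) · f (suc s) j) ⊕ (ι (suc r) · mulλ-1 (f s j))
f-inner zero r refl i =
  cong₂ _+_ (f-top (suc r) i) (trans (mulλ-1-cong (f-top r) i) (mulλ-1-· (ι (suc r)) (f r 0) i))
f-inner (suc j) r {suc t} refl i = begin
  f (3 ℕ.+ t) (suc j) i + mulλ-1 (f (2 ℕ.+ t) (suc j)) i
    ≡⟨ cong₂ _+_ (f-inner j (suc r) (+-suc j r) i)
                 (trans (mulλ-1-cong (f-inner j r refl) i)
                        (mulλ-1-combination (ι (2 ℕ.+ t)) (ι (suc r)) (f (suc t) j) (mulλ-1 (f t j)) i)) ⟩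
  (ι (3 ℕ.+ t) * a + ι (2 ℕ.+ r) * b) + (ι (2 ℕ.+ t) * b + ι (suc r) * c)
    ≡⟨ ι-regroup (2 ℕ.+ t) (suc r) a b (ι (suc r) * c) ⟩
  ι (3 ℕ.+ t) * (a + b) + (ι (suc r) * b + ι (suc r) * c)
    ≡⟨ cong (λ u → ι (3 ℕ.+ t) * (a + b) + u) (*-distribˡ-+ (ι (suc r)) b c) ⟨
  ι (3 ℕ.+ t) * (a + b) + ι (suc r) * (b + c)
    ≡⟨ cong (λ u → ι (3 ℕ.+ t) * (a + b) + ι (suc r) * u) (mulλ-1-⊕ (f (suc t) j) (mulλ-1 (f t j)) i) ⟨
  ι (3 ℕ.+ t) * f (2 ℕ.+ t) (suc j) i + ι (suc r) * mulλ-1 (f (suc t) (suc j)) i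
    ∎
  where
  open ≡-Reasoning
  a b c : ℚ
  a = f (2 ℕ.+ t) j i
  b = mulλ-1 (f (suc t) j) i
  c = mulλ-1 (mulλ-1 (f t j)) i

-- (diagonal) e^0_{m+1} = (m+1) e^0_m + (λ-1)^{m+1}, by induction on m using
-- the case r = 0 of (inner).
f-diagonal : ∀ m → f (suc m) (suc m) ≗ (ι (suc m) · f m m) ⊕ powλ-1 (suc m)
f-diagonal zero i = cong₂ _+_ (f-top zero i) (mulλ-1-cong f00≗1 i)
  where
  f00≗1 : f 0 0 ≗ powλ-1 0
  f00≗1 zero    = refl
  f00≗1 (suc i) = refl
f-diagonal (suc m) i = begin
  f (2 ℕ.+ m) (suc m) i + mulλ-1 (f (suc m) (suc m)) i
    ≡⟨ cong₂ _+_ (f-inner m 0 (ℕP.+-identityʳ m) i)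
                 (trans (mulλ-1-cong (f-diagonal m) i)
                        (trans (mulλ-1-⊕ (ι (suc m) · f m m) (powλ-1 (suc m)) i)
                               (cong (_+ p) (mulλ-1-· (ι (suc m)) (f m m) i)))) ⟩
  (ι (2 ℕ.+ m) * a + ι 1 * b) + (ι (suc m) * b + p)
    ≡⟨ ι-regroup (suc m) 0 a b p ⟩
  ι (2 ℕ.+ m) * (a + b) + (ι 0 * b + p)
    ≡⟨ cong (λ u → ι (2 ℕ.+ m) * (a + b) + (u + p)) (*-zeroˡ b) ⟩
  ι (2 ℕ.+ m) * (a + b) + (0ℚ + p)
    ≡⟨ cong (λ u → ι (2 ℕ.+ m) * (a + b) + u) (+-identityˡ p) ⟩
  ι (2 ℕ.+ m) * (a + b) + p
    ∎
  where
  open ≡-Reasoning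
  a b p : ℚ
  a = f (suc m) m i
  b = mulλ-1 (f m m) i
  p = powλ-1 (2 ℕ.+ m) i

d-index : ∀ {k j n} → k ℕ.+ j ≡ n → d k n ≗ inv! k · f n j
d-index {k} {j} refl i = cong (λ x → inv! k * f (k ℕ.+ j) x i) (m+n∸m≡n k j)

-- The case k ≥ 1: (inner) divided by (r+1)!, using (r+1)/(r+1)! = 1/r!.
d-inner : ∀ r j →
  d (suc r) (2 ℕ.+ (r ℕ.+ j))
    ≗ (ι (2 ℕ.+ (r ℕ.+ j)) · d (suc r) (suc (r ℕ.+ j))) ⊕ mulλ-1 (d r (r ℕ.+ j))
d-inner r j i = begin
  d (suc r) (2 ℕ.+ t) i
    ≡⟨ d-index {suc r} {suc j} (cong suc (+-suc r j)) i ⟩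
  c * f (2 ℕ.+ t) (suc j) i
    ≡⟨ cong (c *_) (f-inner j r (ℕP.+-comm j r) i) ⟩
  c * (ι (2 ℕ.+ t) * x + ι (suc r) * y)
    ≡⟨ solve 5 (λ c n k x y → c :* (n :* x :+ k :* y) := n :* (c :* x) :+ (c :* k) :* y)
               refl c (ι (2 ℕ.+ t)) (ι (suc r)) x y ⟩
  ι (2 ℕ.+ t) * (c * x) + (c * ι (suc r)) * y
    ≡⟨ cong (λ u → ι (2 ℕ.+ t) * (c * x) + u * y) (inv!-suc r) ⟩
  ι (2 ℕ.+ t) * (c * x) + inv! r * y
    ≡⟨ cong₂ (λ u v → ι (2 ℕ.+ t) * u + v) (d-index {suc r} {j} refl i)
             (trans (mulλ-1-cong (d-index {r} {j} refl) i) (mulλ-1-· (inv! r) (f t j) i)) ⟨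
  ι (2 ℕ.+ t) * d (suc r) (suc t) i + mulλ-1 (d r t) i
    ∎
  where
  open ≡-Reasoning
  t : ℕ
  t = r ℕ.+ j
  c x y : ℚ
  c = inv! (suc r)
  x = f (suc t) j i
  y = mulλ-1 (f t j) i

d-diagonal : ∀ m → d 0 (suc m) ≗ (ι (suc m) · d 0 m) ⊕ powλ-1 (suc m)
d-diagonal m i = begin
  d 0 (suc m) i                          ≡⟨ d0≗f (suc m) i ⟩
  f (suc m) (suc m) i                    ≡⟨ f-diagonal m i ⟩
  ι (suc m) * f m m i + powλ-1 (suc m) i ≡⟨ cong (λ u → ι (suc m) * u + powλ-1 (suc m) i) (d0≗f m i) ⟨
  ι (suc m) * d 0 m i + powλ-1 (suc m) i ∎
  where
  open ≡-Reasoning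
  d0≗f : ∀ n → d 0 n ≗ f n n
  d0≗f n i = *-identityˡ (f n n i)

proposition2 : (k n : ℕ) → k < n → (i : ℕ) →
    d k n i ≡ ((((+ n) / 1) · d k (n ∸ 1)) ⊕ mulλ-1 (dShift k (n ∸ 1))) i
proposition2 zero    (suc m)       _                 = d-diagonal m
proposition2 (suc r) (suc (suc m)) (s≤s (s≤s r≤m)) with m≤n⇒∃[o]m+o≡n r≤m
... | j , refl = d-inner r j
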